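{- For each bimodal formula $\phi\in\mathsf{L}_\mu$ (actions $\{h,v\}$) there is a monomodal formula $\phi'$ (single action) with the same free variables as $\phi$, such that $\phi'\in\mathcal{C}_1(x)$ whenever $\phi\in\mathcal{C}_1(x)$, and with the following property: for each bimodal model $\mathcal{M}$ there is a monomodal model $\mathcal{M}'$, not depending on $\phi$, such that (i) $|\mathcal{M}|\subseteq|\mathcal{M}'|$; (ii) for each $s\in|\mathcal{M}|$, $\mathcal{M},s\Vdash\phi$ iff $\mathcal{M}',s\Vdash\phi'$; (iii) $(\phi'_{\mathcal{M}'})^\alpha(\emptyset)=\phi_{\mathcal{M}}^\alpha(\emptyset)$ for each ordinal $\alpha$.
   Context: $\mathsf{L}_\mu$ is the modal $\mu$-calculus over a finite action set: $\phi ::= y \mid \neg y \mid \top \mid \phi\wedge\phi \mid \bot \mid \phi\vee\phi \mid \langle a\rangle\phi \mid [a]\phi \mid \mu_z.\phi \mid \nu_z.\phi$ with standard Kripke semantics. For a model $\mathcal{N}$, $\phi_{\mathcal{N}}$ is $S\mapsto[\![\phi]\!]_{\mathcal{N}[x\mapsto S]}$, with approximants $\phi_{\mathcal{N}}^0(\emptyset)=\emptyset$, $\phi_{\mathcal{N}}^{\alpha+1}(\emptyset)=\phi_{\mathcal{N}}(\phi_{\mathcal{N}}^\alpha(\emptyset))$, and unions at limit ordinals. $\mathcal{C}_1(X)$ is generated by $\phi ::= x \mid \psi \mid \top\mid\bot\mid \phi\wedge\phi\mid\phi\vee\phi\mid\langle a\rangle\phi\mid \mu_z.\chi\mid\nu_z.\chi$,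 with $x\in X$, $\psi$ containing no variable of $X$, $\chi\in\mathcal{C}_1(X\cup\{z\})$; $\mathcal{C}_1(x)=\mathcal{C}_1(\{x\})$. -}

module Defs where

open import Level using (Level; _⊔_; Lift) renaming (zero to lzero; suc to lsuc)
open import Data.Nat using (ℕ; _≟_)
open import Data.Product using (Σ; _×_; _,_)
open import Data.Sum using (_⊎_)
open import Data.Empty using (⊥)
open import Data.Unit using (⊤)
open import Relation.Nullary using (¬_; yes; no)
open import Relation.Binary.PropositionalEquality using (_≡_; _≢_)

Var : Set
Var = ℕ

-- Formulas of L_mu over an action set A (negation normal form, named binders).
data Form (A : Set) : Set where
  var    : Var → Form A
  nvar   : Var → Form A
  tt     : Form A
  ff     : Form A
  _∧_    : Form A → Form A → Form A
  _∨_    : Form A → Form A → Form A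
  ⟨_⟩_   : A → Form A → Form A
  [_]_   : A → Form A → Form A
  μ      : Var → Form A → Form A
  ν      : Var → Form A → Form A

data Bi : Set where
  h v : Bi

record Model (A : Set) : Set₁ where
  field
    State : Set
    R     : A → State → State → Set
    V     : Var → State → Set
open Model public

upd : ∀ {ℓ} {St : Set} → (Var → St → Set ℓ) → Var → (St → Set ℓ) → Var → St → Set ℓ
upd ρ z S y with y ≟ z
... | yes _ = S
... | no  _ = ρ y

-- Least / greatest fixed points: intersection of prefixed points / union of
-- postfixed points (Knaster–Tarski), quantifying over predicates State → Set.
⟦_⟧ : ∀ {A ℓ} → Form A → (M : Model A) → (Var → State M → Set ℓ) → State M → Set (lsuc lzero ⊔ ℓ)
⟦ var y   ⟧ M ρ s = Lift (lsuc lzero) (ρ y s)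
⟦ nvar y  ⟧ M ρ s = Lift (lsuc lzero) (¬ ρ y s)
⟦ tt      ⟧ M ρ s = Lift _ ⊤
⟦ ff      ⟧ M ρ s = Lift _ ⊥
⟦ φ ∧ ψ   ⟧ M ρ s = ⟦ φ ⟧ M ρ s × ⟦ ψ ⟧ M ρ s
⟦ φ ∨ ψ   ⟧ M ρ s = ⟦ φ ⟧ M ρ s ⊎ ⟦ ψ ⟧ M ρ s
⟦ ⟨ a ⟩ φ ⟧ M ρ s = Σ (State M) λ t → R M a s t × ⟦ φ ⟧ M ρ t
⟦ [ a ] φ ⟧ M ρ s = (t : State M) → R M a s t → ⟦ φ ⟧ M ρ t
⟦_⟧ {ℓ = ℓ} (μ z φ) M ρ s = (S : State M → Set) →
    ((t : State M) → ⟦ φ ⟧ M (upd ρ z (λ u → Lift ℓ (S u))) t → S t) → S s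
⟦_⟧ {ℓ = ℓ} (ν z φ) M ρ s = Σ (State M → Set) λ S →
    ((t : State M) → S t → ⟦ φ ⟧ M (upd ρ z (λ u → Lift ℓ (S u))) t) × S s

_,_⊩_ : ∀ {A} (M : Model A) → State M → Form A → Set₁
M , s ⊩ φ = ⟦ φ ⟧ M (V M) s

-- Ordinals as well-founded (Brouwer) trees with Set-indexed limits.
data Ord : Set₁ where
  zer : Ord
  suc : Ord → Ord
  lim : {I : Set} → (I → Ord) → Ord

-- Approximants  (φ_M)^α(∅)  where φ_M : S ↦ [[φ]]_{M[x ↦ S]}.
approx : ∀ {A} (M : Model A) (φ : Form A) (x : Var) → Ord → State M → Set₁
approx M φ x zer       s = Lift _ ⊥
approx M φ x (suc α)   s = ⟦ φ ⟧ M (upd (λ y t → Lift (lsuc lzero) (V M y t)) x (approx M φ x α)) s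
approx M φ x (lim {I} f) s = Σ I λ i → approx M φ x (f i) s

data FreeIn {A : Set} (y : Var) : Form A → Set where
  f-var  : FreeIn y (var y)
  f-nvar : FreeIn y (nvar y)
  f-∧l   : ∀ {φ ψ} → FreeIn y φ → FreeIn y (φ ∧ ψ)
  f-∧r   : ∀ {φ ψ} → FreeIn y ψ → FreeIn y (φ ∧ ψ)
  f-∨l   : ∀ {φ ψ} → FreeIn y φ → FreeIn y (φ ∨ ψ)
  f-∨r   : ∀ {φ ψ} → FreeIn y ψ → FreeIn y (φ ∨ ψ)
  f-⟨⟩   : ∀ {a φ} → FreeIn y φ → FreeIn y (⟨ a ⟩ φ)
  f-[]   : ∀ {a φ} → FreeIn y φ → FreeIn y ([ a ] φ)
  f-μ    : ∀ {z φ} → FreeIn y φ → y ≢ z → FreeIn y (μ z φ)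
  f-ν    : ∀ {z φ} → FreeIn y φ → y ≢ z → FreeIn y (ν z φ)

data C₁ {A : Set} : (Var → Set) → Form A → Set₁ where
  c-var : ∀ {X x} → X x → C₁ X (var x)
  c-ψ   : ∀ {X ψ} → ((y : Var) → FreeIn y ψ → ¬ X y) → C₁ X ψ
  c-tt  : ∀ {X} → C₁ X tt
  c-ff  : ∀ {X} → C₁ X ff
  c-∧   : ∀ {X φ ψ} → C₁ X φ → C₁ X ψ → C₁ X (φ ∧ ψ)
  c-∨   : ∀ {X φ ψ} → C₁ X φ → C₁ X ψ → C₁ X (φ ∨ ψ)
  c-⟨⟩  : ∀ {X a φ} → C₁ X φ → C₁ X (⟨ a ⟩ φ)
  c-μ   : ∀ {X z χ} → C₁ (λ y → X y ⊎ y ≡ z) χ → C₁ X (μ z χ)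
  c-ν   : ∀ {X z χ} → C₁ (λ y → X y ⊎ y ≡ z) χ → C₁ X (ν z χ)

C₁[_] : ∀ {A : Set} → Var → Form A → Set₁
C₁[ x ] φ = C₁ (λ y → y ≡ x) φ

_⇔_ : ∀ {a b} → Set a → Set b → Set (a ⊔ b)
P ⇔ Q = (P → Q) × (Q → P)

-- Each bimodal state s is kept as orig s and each a-edge s → t is replaced by the
-- two-step path orig s → mid a s → orig t.  Small gadgets hanging off the new
-- states make "being orig", "being mid h" and "being mid v" definable by closed
-- formulas, exactly and in every model, so ⟨a⟩ and [a] become two-step modalities
-- relativised to these markers.  Off the copy of M, least fixed points are
-- transferred by extending prefixed points with ⊤, greatest fixed points by
-- extending postfixed points with ⊥; and since φ' = atOrig ∧ tr φ, every
-- approximant of φ' lives on the copy of M.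
module Submission where

open import Defs
open import Data.Product using (Σ; _×_; _,_; proj₁; proj₂)
open import Data.Sum using (_⊎_; inj₁; inj₂)
open import Data.Empty using (⊥; ⊥-elim)
open import Data.Unit using (⊤)
import Data.Unit as Unit
open import Data.Nat using (_≟_)
open import Function using (case_of_)
open import Level using (Lift; lift; lower)
open import Relation.Nullary using (¬_; yes; no)
open import Relation.Binary.PropositionalEquality using (_≡_; _≢_; refl)

⇔-refl : ∀ {a} {P : Set a} → P ⇔ P
⇔-refl = (λ p → p) , (λ p → p)

other : Bi → Bi
other h = v
other v = h

other≢ : ∀ a → a ≢ other a
other≢ h ()
other≢ v ()

≡-or-other : ∀ a b → b ≡ a ⊎ b ≡ other a
≡-or-other h h = inj₁ refl
≡-or-other h v = inj₂ refl
≡-or-other v h = inj₂ refl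
≡-or-other v v = inj₁ refl

◇ □ : Form ⊤ → Form ⊤
◇ φ = ⟨ Unit.tt ⟩ φ
□ φ = [ Unit.tt ] φ

-- In the model built below, atD holds only at D, atE only at E (all successors
-- dead), atMid h only at mid h s (successors D and E), atMid v only at mid v s
-- (successor E, no dead successor) and atOrig only at orig s (successor mid v s).
atD atE atOrig noPath₂ : Form ⊤
atD = □ ff
atE = ◇ tt ∧ □ atD
noPath₂ = □ atD

atMid : Bi → Form ⊤
atMid h = ◇ atD ∧ ◇ atE
atMid v = ◇ atE ∧ □ (◇ tt)

atOrig = ◇ (atMid v)

-- Constructive negations relative to where they are evaluated: among the
-- successors of orig s, atMid (other a) is ¬ atMid a; among those of mid a s
-- (D, E and orig states), noPath₂ is ¬ atOrig.
relay⟨_⟩ relay[_] : Bi → Form ⊤ → Form ⊤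
relay⟨ a ⟩ ψ = ◇ (atMid a ∧ ◇ (atOrig ∧ ψ))
relay[ a ] ψ = □ (atMid (other a) ∨ □ (noPath₂ ∨ ψ))

tr : Form Bi → Form ⊤
tr (var y)   = var y
tr (nvar y)  = nvar y
tr tt        = tt
tr ff        = ff
tr (φ ∧ ψ)   = tr φ ∧ tr ψ
tr (φ ∨ ψ)   = tr φ ∨ tr ψ
tr (⟨ a ⟩ φ) = relay⟨ a ⟩ (tr φ)
tr ([ a ] φ) = relay[ a ] (tr φ)
tr (μ z φ)   = μ z (tr φ)
tr (ν z φ)   = ν z (tr φ)

T : Form Bi → Form ⊤
T φ = atOrig ∧ tr φ

data VarFree {A : Set} : Form A → Set where
  tt  : VarFree tt
  ff  : VarFree ff
  _∧_ : ∀ {φ ψ} → VarFree φ → VarFree ψ → VarFree (φ ∧ ψ)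
  _∨_ : ∀ {φ ψ} → VarFree φ → VarFree ψ → VarFree (φ ∨ ψ)
  ⟨_⟩_ : ∀ {φ} a → VarFree φ → VarFree (⟨ a ⟩ φ)
  [_]_ : ∀ {φ} a → VarFree φ → VarFree ([ a ] φ)

VarFree⇒¬FreeIn : ∀ {A} {φ : Form A} {y} → VarFree φ → ¬ FreeIn y φ
VarFree⇒¬FreeIn (p ∧ _)   (f-∧l q) = VarFree⇒¬FreeIn p q
VarFree⇒¬FreeIn (_ ∧ p)   (f-∧r q) = VarFree⇒¬FreeIn p q
VarFree⇒¬FreeIn (p ∨ _)   (f-∨l q) = VarFree⇒¬FreeIn p q
VarFree⇒¬FreeIn (_ ∨ p)   (f-∨r q) = VarFree⇒¬FreeIn p q
VarFree⇒¬FreeIn (⟨ _ ⟩ p) (f-⟨⟩ q) = VarFree⇒¬FreeIn p q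
VarFree⇒¬FreeIn ([ _ ] p) (f-[] q) = VarFree⇒¬FreeIn p q

VarFree⇒C₁ : ∀ {A} {φ : Form A} {X} → VarFree φ → C₁ X φ
VarFree⇒C₁ p = c-ψ λ _ q _ → VarFree⇒¬FreeIn p q

atD-varFree : VarFree atD
atD-varFree = [ _ ] ff

atE-varFree : VarFree atE
atE-varFree = (⟨ _ ⟩ tt) ∧ ([ _ ] atD-varFree)

atMid-varFree : ∀ a → VarFree (atMid a)
atMid-varFree h = (⟨ _ ⟩ atD-varFree) ∧ (⟨ _ ⟩ atE-varFree)
atMid-varFree v = (⟨ _ ⟩ atE-varFree) ∧ ([ _ ] ⟨ _ ⟩ tt)

atOrig-varFree : VarFree atOrig
atOrig-varFree = ⟨ _ ⟩ (atMid-varFree v)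

noPath₂-varFree : VarFree noPath₂
noPath₂-varFree = [ _ ] atD-varFree

FreeIn-tr⁺ : ∀ {y} φ → FreeIn y φ → FreeIn y (tr φ)
FreeIn-tr⁺ (var _)   f-var    = f-var
FreeIn-tr⁺ (nvar _)  f-nvar   = f-nvar
FreeIn-tr⁺ (φ ∧ _)   (f-∧l p) = f-∧l (FreeIn-tr⁺ φ p)
FreeIn-tr⁺ (_ ∧ ψ)   (f-∧r p) = f-∧r (FreeIn-tr⁺ ψ p)
FreeIn-tr⁺ (φ ∨ _)   (f-∨l p) = f-∨l (FreeIn-tr⁺ φ p)
FreeIn-tr⁺ (_ ∨ ψ)   (f-∨r p) = f-∨r (FreeIn-tr⁺ ψ p)
FreeIn-tr⁺ (⟨ _ ⟩ φ) (f-⟨⟩ p) = f-⟨⟩ (f-∧r (f-⟨⟩ (f-∧r (FreeIn-tr⁺ φ p))))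
FreeIn-tr⁺ ([ _ ] φ) (f-[] p) = f-[] (f-∨r (f-[] (f-∨r (FreeIn-tr⁺ φ p))))
FreeIn-tr⁺ (μ _ φ)   (f-μ p z≢) = f-μ (FreeIn-tr⁺ φ p) z≢
FreeIn-tr⁺ (ν _ φ)   (f-ν p z≢) = f-ν (FreeIn-tr⁺ φ p) z≢

FreeIn-tr⁻ : ∀ {y} φ → FreeIn y (tr φ) → FreeIn y φ
FreeIn-tr⁻ (var _)   f-var    = f-var
FreeIn-tr⁻ (nvar _)  f-nvar   = f-nvar
FreeIn-tr⁻ (φ ∧ _)   (f-∧l p) = f-∧l (FreeIn-tr⁻ φ p)
FreeIn-tr⁻ (_ ∧ ψ)   (f-∧r p) = f-∧r (FreeIn-tr⁻ ψ p)
FreeIn-tr⁻ (φ ∨ _)   (f-∨l p) = f-∨l (FreeIn-tr⁻ φ p)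
FreeIn-tr⁻ (_ ∨ ψ)   (f-∨r p) = f-∨r (FreeIn-tr⁻ ψ p)
FreeIn-tr⁻ (⟨ a ⟩ φ) (f-⟨⟩ (f-∧l p)) = ⊥-elim (VarFree⇒¬FreeIn (atMid-varFree a) p)
FreeIn-tr⁻ (⟨ _ ⟩ φ) (f-⟨⟩ (f-∧r (f-⟨⟩ (f-∧l p)))) = ⊥-elim (VarFree⇒¬FreeIn atOrig-varFree p)
FreeIn-tr⁻ (⟨ _ ⟩ φ) (f-⟨⟩ (f-∧r (f-⟨⟩ (f-∧r p)))) = f-⟨⟩ (FreeIn-tr⁻ φ p)
FreeIn-tr⁻ ([ a ] φ) (f-[] (f-∨l p)) = ⊥-elim (VarFree⇒¬FreeIn (atMid-varFree (other a)) p)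
FreeIn-tr⁻ ([ _ ] φ) (f-[] (f-∨r (f-[] (f-∨l p)))) = ⊥-elim (VarFree⇒¬FreeIn noPath₂-varFree p)
FreeIn-tr⁻ ([ _ ] φ) (f-[] (f-∨r (f-[] (f-∨r p)))) = f-[] (FreeIn-tr⁻ φ p)
FreeIn-tr⁻ (μ _ φ)   (f-μ p z≢) = f-μ (FreeIn-tr⁻ φ p) z≢
FreeIn-tr⁻ (ν _ φ)   (f-ν p z≢) = f-ν (FreeIn-tr⁻ φ p) z≢

FreeIn-T : ∀ φ y → FreeIn y φ ⇔ FreeIn y (T φ)
FreeIn-T φ y = (λ p → f-∧r (FreeIn-tr⁺ φ p)) , λ
  { (f-∧l p) → ⊥-elim (VarFree⇒¬FreeIn atOrig-varFree p)
  ; (f-∧r p) → FreeIn-tr⁻ φ p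
  }

C₁-tr : ∀ {X} φ → C₁ X φ → C₁ X (tr φ)
C₁-tr φ       (c-ψ p)   = c-ψ λ y q → p y (FreeIn-tr⁻ φ q)
C₁-tr _       (c-var p) = c-var p
C₁-tr _       c-tt      = c-tt
C₁-tr _       c-ff      = c-ff
C₁-tr (φ ∧ ψ) (c-∧ p q) = c-∧ (C₁-tr φ p) (C₁-tr ψ q)
C₁-tr (φ ∨ ψ) (c-∨ p q) = c-∨ (C₁-tr φ p) (C₁-tr ψ q)
C₁-tr (⟨ a ⟩ φ) (c-⟨⟩ p) =
  c-⟨⟩ (c-∧ (VarFree⇒C₁ (atMid-varFree a)) (c-⟨⟩ (c-∧ (VarFree⇒C₁ atOrig-varFree) (C₁-tr φ p))))
C₁-tr (μ _ φ) (c-μ p)   = c-μ (C₁-tr φ p)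
C₁-tr (ν _ φ) (c-ν p)   = c-ν (C₁-tr φ p)

C₁-T : ∀ {X} φ → C₁ X φ → C₁ X (T φ)
C₁-T φ p = c-∧ (VarFree⇒C₁ atOrig-varFree) (C₁-tr φ p)

module Monomodal (M : Model Bi) where

  data St : Set where
    orig : State M → St
    mid  : Bi → State M → St
    D E  : St

  data Step : St → St → Set where
    orig→mid : ∀ {a s} → Step (orig s) (mid a s)
    mid→orig : ∀ {a s t} → R M a s t → Step (mid a s) (orig t)
    mid→E    : ∀ {a s} → Step (mid a s) E
    midh→D   : ∀ {s} → Step (mid h s) D
    E→D      : Step E D

  orig-injective : ∀ s s' → orig s ≡ orig s' → s ≡ s'
  orig-injective _ _ refl = refl

  mid-injective : ∀ {a b s t} → mid a s ≡ mid b t → a ≡ b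
  mid-injective refl = refl

  Step-into-mid : ∀ {t a s} → Step t (mid a s) → t ≡ orig s
  Step-into-mid orig→mid = refl

  Step-path⇒R : ∀ {a s s' t} → Step (orig s) (mid a s') → Step (mid a s') (orig t) → R M a s t
  Step-path⇒R orig→mid (mid→orig r) = r

  Val : Var → St → Set
  Val y (orig s) = V M y s
  Val y _        = ⊥

  M' : Model ⊤
  M' = record { State = St ; R = λ _ → Step ; V = Val }

  module Markers {ℓ} (ρ : Var → St → Set ℓ) where

    _⊨_ : St → Form ⊤ → Set (Level.suc Level.zero Level.⊔ ℓ)
    t ⊨ c = ⟦ c ⟧ M' ρ t

    ◇-exact : ∀ c {t u} → (∀ {w} → w ⊨ c → w ≡ u) → t ⊨ ◇ c → Step t u
    ◇-exact _ exact (_ , st , p) with exact p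
    ... | refl = st

    atD-D : D ⊨ atD
    atD-D _ ()

    atD⇒D : ∀ {t} → t ⊨ atD → t ≡ D
    atD⇒D {orig s}  p = ⊥-elim (lower (p (mid h s) orig→mid))
    atD⇒D {mid _ _} p = ⊥-elim (lower (p E mid→E))
    atD⇒D {D}       _ = refl
    atD⇒D {E}       p = ⊥-elim (lower (p D E→D))

    atE-E : E ⊨ atE
    atE-E = (D , E→D , lift Unit.tt) , λ { _ E→D → atD-D }

    atE⇒E : ∀ {t} → t ⊨ atE → t ≡ E
    atE⇒E {orig s}  (_ , p) = case atD⇒D (p (mid h s) orig→mid) of λ ()
    atE⇒E {mid _ _} (_ , p) = case atD⇒D (p E mid→E) of λ ()
    atE⇒E {D}       ((_ , () , _) , _)
    atE⇒E {E}       _ = refl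

    atMid-mid : ∀ a s → mid a s ⊨ atMid a
    atMid-mid h s = (D , midh→D , atD-D) , (E , mid→E , atE-E)
    atMid-mid v s = (E , mid→E , atE-E) , λ
      { _ (mid→orig _) → mid h _ , orig→mid , lift Unit.tt
      ; _ mid→E        → D , E→D , lift Unit.tt
      }

    atMid⇒mid : ∀ a {t} → t ⊨ atMid a → Σ (State M) λ s → t ≡ mid a s
    atMid⇒mid h (p , q) = steps-to-D-and-E (◇-exact atD atD⇒D p) (◇-exact atE atE⇒E q)
      where
      steps-to-D-and-E : ∀ {t} → Step t D → Step t E → Σ (State M) λ s → t ≡ mid h s
      steps-to-D-and-E midh→D _ = _ , refl
      steps-to-D-and-E E→D    ()
    atMid⇒mid v (p , live) = only-mid-v (◇-exact atE atE⇒E p) live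
      where
      only-mid-v : ∀ {t} → Step t E → t ⊨ □ (◇ tt) → Σ (State M) λ s → t ≡ mid v s
      only-mid-v (mid→E {h}) live = case live D midh→D of λ { (_ , () , _) }
      only-mid-v (mid→E {v}) _    = _ , refl

    atOrig-orig : ∀ s → orig s ⊨ atOrig
    atOrig-orig s = mid v s , orig→mid , atMid-mid v s

    atOrig⇒orig : ∀ {t} → t ⊨ atOrig → Σ (State M) λ s → t ≡ orig s
    atOrig⇒orig (_ , st , p) with atMid⇒mid v p
    ... | s , refl = s , Step-into-mid st

    noPath₂-D : D ⊨ noPath₂
    noPath₂-D _ ()

    noPath₂-E : E ⊨ noPath₂
    noPath₂-E _ E→D = atD-D

    ¬noPath₂-orig : ∀ {s} → ¬ orig s ⊨ noPath₂
    ¬noPath₂-orig {s} p = lower (p (mid h s) orig→mid E mid→E)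

  open Markers

  Agree : ∀ {ℓ} → (Var → State M → Set ℓ) → (Var → St → Set ℓ) → Set ℓ
  Agree ρ ρ' = ∀ y s → ρ y s ⇔ ρ' y (orig s)

  Agree-upd : ∀ {ℓ} {ρ : Var → State M → Set ℓ} {ρ' : Var → St → Set ℓ}
              {S : State M → Set ℓ} {S' : St → Set ℓ} z →
              Agree ρ ρ' → (∀ s → S s ⇔ S' (orig s)) → Agree (upd ρ z S) (upd ρ' z S')
  Agree-upd z ρ≈ρ' S≈S' y s with y ≟ z
  ... | yes _ = S≈S' s
  ... | no  _ = ρ≈ρ' y s

  extend⊤ extend⊥ : (State M → Set) → St → Set
  extend⊤ S (orig s) = S s
  extend⊤ S _        = ⊤
  extend⊥ S (orig s) = S s
  extend⊥ S _        = ⊥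

  tr-sound : ∀ {ℓ} φ {ρ : Var → State M → Set ℓ} {ρ' : Var → St → Set ℓ} →
             Agree ρ ρ' → ∀ s → ⟦ φ ⟧ M ρ s ⇔ ⟦ tr φ ⟧ M' ρ' (orig s)
  tr-sound (var y) ρ≈ρ' s =
    (λ p → lift (proj₁ (ρ≈ρ' y s) (lower p))) , (λ p → lift (proj₂ (ρ≈ρ' y s) (lower p)))
  tr-sound (nvar y) ρ≈ρ' s =
    (λ p → lift λ q → lower p (proj₂ (ρ≈ρ' y s) q)) , (λ p → lift λ q → lower p (proj₁ (ρ≈ρ' y s) q))
  tr-sound tt _ _ = ⇔-refl
  tr-sound ff _ _ = ⇔-refl
  tr-sound (φ ∧ ψ) ρ≈ρ' s =
    (λ { (p , q) → proj₁ (tr-sound φ ρ≈ρ' s) p , proj₁ (tr-sound ψ ρ≈ρ' s) q }) ,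
    (λ { (p , q) → proj₂ (tr-sound φ ρ≈ρ' s) p , proj₂ (tr-sound ψ ρ≈ρ' s) q })
  tr-sound (φ ∨ ψ) ρ≈ρ' s =
    (λ { (inj₁ p) → inj₁ (proj₁ (tr-sound φ ρ≈ρ' s) p) ; (inj₂ q) → inj₂ (proj₁ (tr-sound ψ ρ≈ρ' s) q) }) ,
    (λ { (inj₁ p) → inj₁ (proj₂ (tr-sound φ ρ≈ρ' s) p) ; (inj₂ q) → inj₂ (proj₂ (tr-sound ψ ρ≈ρ' s) q) })
  tr-sound (⟨ a ⟩ φ) {ρ' = ρ'} ρ≈ρ' s = to , from
    where
    to : ⟦ ⟨ a ⟩ φ ⟧ M _ s → ⟦ tr (⟨ a ⟩ φ) ⟧ M' ρ' (orig s)
    to (t , r , p) = mid a s , orig→mid , atMid-mid ρ' a s ,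
                     orig t , mid→orig r , atOrig-orig ρ' t , proj₁ (tr-sound φ ρ≈ρ' t) p
    from : ⟦ tr (⟨ a ⟩ φ) ⟧ M' ρ' (orig s) → ⟦ ⟨ a ⟩ φ ⟧ M _ s
    from (_ , st , m , _ , st' , o , q) with atMid⇒mid ρ' a m | atOrig⇒orig ρ' o
    ... | _ , refl | t , refl = t , Step-path⇒R st st' , proj₂ (tr-sound φ ρ≈ρ' t) q
  tr-sound ([ a ] φ) {ρ' = ρ'} ρ≈ρ' s = to , from
    where
    to : ⟦ [ a ] φ ⟧ M _ s → ⟦ tr ([ a ] φ) ⟧ M' ρ' (orig s)
    to f _ (orig→mid {b}) with ≡-or-other a b
    ... | inj₂ refl = inj₁ (atMid-mid ρ' (other a) s)
    ... | inj₁ refl = inj₂ λ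
      { _ (mid→orig r) → inj₂ (proj₁ (tr-sound φ ρ≈ρ' _) (f _ r))
      ; _ mid→E        → inj₁ (noPath₂-E ρ')
      ; _ midh→D       → inj₁ (noPath₂-D ρ')
      }
    from : ⟦ tr ([ a ] φ) ⟧ M' ρ' (orig s) → ⟦ [ a ] φ ⟧ M _ s
    from g t r with g (mid a s) orig→mid
    ... | inj₁ m = ⊥-elim (other≢ a (mid-injective (proj₂ (atMid⇒mid ρ' (other a) m))))
    ... | inj₂ k with k (orig t) (mid→orig r)
    ...   | inj₁ np = ⊥-elim (¬noPath₂-orig ρ' np)
    ...   | inj₂ q  = proj₂ (tr-sound φ ρ≈ρ' t) q
  tr-sound (μ z φ) ρ≈ρ' s = to , from
    where
    to : ⟦ μ z φ ⟧ M _ s → ⟦ tr (μ z φ) ⟧ M' _ (orig s)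
    to p S' pre' = p (λ t → S' (orig t)) λ t q →
      pre' (orig t) (proj₁ (tr-sound φ (Agree-upd z ρ≈ρ' λ _ → ⇔-refl) t) q)
    from : ⟦ tr (μ z φ) ⟧ M' _ (orig s) → ⟦ μ z φ ⟧ M _ s
    from p S pre = p (extend⊤ S) λ
      { (orig t) q → pre t (proj₂ (tr-sound φ (Agree-upd z ρ≈ρ' λ _ → ⇔-refl) t) q)
      ; (mid _ _) _ → Unit.tt
      ; D _ → Unit.tt
      ; E _ → Unit.tt
      }
  tr-sound (ν z φ) ρ≈ρ' s = to , from
    where
    to : ⟦ ν z φ ⟧ M _ s → ⟦ tr (ν z φ) ⟧ M' _ (orig s)
    to (S , post , p) = extend⊥ S , (λ
      { (orig t) q → proj₁ (tr-sound φ (Agree-upd z ρ≈ρ' λ _ → ⇔-refl) t) (post t q)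
      ; (mid _ _) ()
      ; D ()
      ; E ()
      }) , p
    from : ⟦ tr (ν z φ) ⟧ M' _ (orig s) → ⟦ ν z φ ⟧ M _ s
    from (S' , post' , p) = (λ t → S' (orig t)) ,
      (λ t q → proj₂ (tr-sound φ (Agree-upd z ρ≈ρ' λ _ → ⇔-refl) t) (post' (orig t) q)) , p

  T-sound : ∀ {ℓ} φ {ρ : Var → State M → Set ℓ} {ρ' : Var → St → Set ℓ} →
            Agree ρ ρ' → ∀ s → ⟦ φ ⟧ M ρ s ⇔ ⟦ T φ ⟧ M' ρ' (orig s)
  T-sound φ {ρ' = ρ'} ρ≈ρ' s =
    (λ p → atOrig-orig ρ' s , proj₁ (tr-sound φ ρ≈ρ' s) p) , (λ p → proj₂ (tr-sound φ ρ≈ρ' s) (proj₂ p))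

  T-sound-⊩ : ∀ φ s → (M , s ⊩ φ) ⇔ (M' , orig s ⊩ T φ)
  T-sound-⊩ φ = T-sound φ λ _ _ → ⇔-refl

  module _ (φ : Form Bi) (x : Var) where

    approx-T : ∀ α s → approx M φ x α s ⇔ approx M' (T φ) x α (orig s)
    approx-T zer     s = ⇔-refl
    approx-T (suc α) s = T-sound φ (Agree-upd x (λ _ _ → ⇔-refl) (approx-T α)) s
    approx-T (lim f) s =
      (λ { (i , p) → i , proj₁ (approx-T (f i) s) p }) , (λ { (i , p) → i , proj₂ (approx-T (f i) s) p })

    approx-T⇒orig : ∀ α t → approx M' (T φ) x α t → Σ (State M) λ s → orig s ≡ t
    approx-T⇒orig zer     t ()
    approx-T⇒orig (suc α) t (o , _)
      with atOrig⇒orig (upd (λ y u → Lift _ (Val y u)) x (approx M' (T φ) x α)) o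
    ... | s , refl = s , refl
    approx-T⇒orig (lim f) t (i , p) = approx-T⇒orig (f i) t p

open Monomodal

proposition6p11 :
    Σ (Form Bi → Form ⊤) λ T →
      ((φ : Form Bi) (y : Var) → FreeIn y φ ⇔ FreeIn y (T φ))
      × ((φ : Form Bi) (x : Var) → C₁[ x ] φ → C₁[ x ] (T φ))
      × ((M : Model Bi) → Σ (Model ⊤) λ M' →
          Σ (State M → State M') λ ι →
            ((s s' : State M) → ι s ≡ ι s' → s ≡ s')
            × ((φ : Form Bi) →
                ((s : State M) → (M , s ⊩ φ) ⇔ (M' , ι s ⊩ T φ))
                × ((x : Var) (α : Ord) →
                    ((s : State M) → approx M φ x α s ⇔ approx M' (T φ) x α (ι s))
                    × ((t : State M') → approx M' (T φ) x α t → Σ (State M) λ s → ι s ≡ t))))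
proposition6p11 =
  T , FreeIn-T , (λ φ _ → C₁-T φ) ,
  λ M → M' M , orig , orig-injective M ,
        λ φ → T-sound-⊩ M φ , λ x α → approx-T M φ x α , approx-T⇒orig M φ x α
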